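{- Let $q>2$, $n\ge 1$, $0\le m\le n$, and let $S\subseteq Z_q^n$ be a nonempty bitrade of order $m$, i.e. $|S\cap F|$ is even for every $(n-m)$-dimensional face $F$ of $Z_q^n$. Then $|S|\ge 2^{m+1}$.
   Context: $Z_q=\{0,\dots,q-1\}$ and $Z_q^n$ is the set of $n$-tuples over $Z_q$. A $k$-dimensional face of $Z_q^n$ is a set obtained by fixing the values of $n-k$ chosen coordinates and letting the other $k$ coordinates range freely over $Z_q$. -}

module Defs where

open import Data.Nat using (ℕ; zero; suc)
open import Data.Bool using (Bool; true; false; _∧_; if_then_else_)
open import Data.Fin using (Fin)
open import Data.Fin.Subset using (Subset; _∈_; ∣_∣)
open import Data.Vec using (Vec; []; _∷_; lookup)
open import Data.List using (List; []; _∷_; concatMap; map; filter; length; allFin)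
open import Data.Product using (Σ; _×_)
open import Relation.Binary.PropositionalEquality using (_≡_)
open import Relation.Nullary.Decidable using (⌊_⌋)
open import Data.Fin.Properties using () renaming (_≟_ to _≟F_)

Point : ℕ → ℕ → Set
Point q n = Vec (Fin q) n

-- Explicit enumeration of all points of Z_q^n (each point exactly once).
allPoints : (q n : ℕ) → List (Point q n)
allPoints q zero    = [] ∷ []
allPoints q (suc n) = concatMap (λ a → map (a ∷_) (allPoints q n)) (allFin q)

PointSet : ℕ → ℕ → Set
PointSet q n = Point q n → Bool

card : ∀ {q n} → PointSet q n → ℕ
card {q} {n} S = length (filter (λ x → S x Data.Bool.≟ true) (allPoints q n))

-- A face of Z_q^n: a set I of fixed coordinates together with the fixed values
-- (the value of `a` outside I is irrelevant). Its dimension is n - |I|.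
inFace : ∀ {q n} → Subset n → Point q n → Point q n → Bool
inFace []           []      []      = true
inFace (true  ∷ I) (a ∷ as) (x ∷ xs) = ⌊ a ≟F x ⌋ ∧ inFace I as xs
inFace (false ∷ I) (_ ∷ as) (_ ∷ xs) = inFace I as xs

cardInFace : ∀ {q n} → PointSet q n → Subset n → Point q n → ℕ
cardInFace S I a = card (λ x → S x ∧ inFace I a x)

Even : ℕ → Set
Even k = Σ ℕ (λ t → k ≡ t Data.Nat.+ t)

IsBitrade : ∀ {q n} → ℕ → PointSet q n → Set
IsBitrade {q} {n} m S = (I : Subset n) → ∣ I ∣ ≡ m → (a : Point q n) → Even (cardInFace S I a)

Nonempty : ∀ {q n} → PointSet q n → Set
Nonempty {q} {n} S = Σ (Point q n) (λ x → S x ≡ true)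

-- Slice S along the first coordinate into S_a = {x | a ∷ x ∈ S}.  A face fixing the first
-- coordinate to a meets only S_a, so every slice is a bitrade of order m − 1.  If two slices
-- are nonempty, induction gives |S| ≥ 2 · 2^m.  If only S_c is nonempty, then also the faces
-- leaving the first coordinate free meet only S_c, so S_c is a bitrade of order m in dimension
-- n − 1; here m < n, because for m = n the faces are single points and S would be empty.
-- For m = 0 the only face is Z_q^n itself, so |S| is even and positive.
module Submission where

open import Defs
open import Data.Nat using (ℕ; zero; suc; _+_; _≤_; _<_; _^_; z≤n; s≤s; _<?_)
open import Data.Nat.Properties
open import Data.Nat.ListAction using (sum)
open import Data.Bool using (Bool; true; false; _∧_)
open import Data.Bool.Properties using (∧-identityʳ; ∧-zeroʳ; ∧-conicalˡ)
open import Data.Fin using (Fin)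
import Data.Fin as Fin
open import Data.Fin.Properties using (any?) renaming (_≟_ to _≟F_; suc-injective to fsuc-injective)
open import Data.Fin.Subset using (Subset; ⊥)
open import Data.Fin.Subset.Properties using (∣⊥∣≡0)
open import Data.Vec using ([]; _∷_)
open import Data.List using (List; []; _∷_; _++_; map; filter; length; concatMap; tabulate; allFin)
open import Data.List.Properties using (length-++; filter-++; filter-≐; map-tabulate; tabulate-cong)
open import Data.List.Relation.Binary.Sublist.Propositional.Properties using (filter⁺; length-mono-≤)
open import Data.List.Relation.Binary.Sublist.Propositional using (⊆-refl)
open import Data.Product using (∃; _,_)
open import Data.Sum using (inj₁; inj₂)
open import Data.Empty using (⊥-elim)
open import Function using (_∘_; id)
open import Relation.Nullary using (¬_; yes; no; ¬?)
open import Relation.Nullary.Decidable using (⌊_⌋; _×-dec_)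
open import Relation.Binary.PropositionalEquality

private
  variable
    A B : Set
    q n m : ℕ

-- card S unfolds to count S (allPoints q n).
count : (A → Bool) → List A → ℕ
count p = length ∘ filter (λ x → p x Data.Bool.≟ true)

count-++ : (p : A → Bool) (xs ys : List A) → count p (xs ++ ys) ≡ count p xs + count p ys
count-++ p xs ys = trans (cong length (filter-++ _ xs ys)) (length-++ (filter _ xs))

count-map : (p : B → Bool) (f : A → B) (xs : List A) → count p (map f xs) ≡ count (p ∘ f) xs
count-map p f [] = refl
count-map p f (x ∷ xs) with p (f x)
... | true  = cong suc (count-map p f xs)
... | false = count-map p f xs

count-concatMap : (p : B → Bool) (h : A → List B) (xs : List A) →
                  count p (concatMap h xs) ≡ sum (map (count p ∘ h) xs)
count-concatMap p h [] = refl
count-concatMap p h (x ∷ xs) =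
  trans (count-++ p (h x) (concatMap h xs)) (cong (count p (h x) +_) (count-concatMap p h xs))

count-cong : {p p′ : A → Bool} → (∀ x → p x ≡ p′ x) → (xs : List A) →
             count p xs ≡ count p′ xs
count-cong p≗p′ xs = cong length (filter-≐ _ _ (trans (sym (p≗p′ _)) , trans (p≗p′ _)) xs)

count-mono : {p p′ : A → Bool} → (∀ x → p x ≡ true → p′ x ≡ true) → (xs : List A) →
             count p xs ≤ count p′ xs
count-mono p⇒p′ xs = length-mono-≤ (filter⁺ _ _ (λ { refl → p⇒p′ _ }) (⊆-refl {x = xs}))

count-none : {p : A → Bool} → (∀ x → p x ≡ false) → (xs : List A) → count p xs ≡ 0
count-none none [] = refl
count-none none (x ∷ xs) rewrite none x = count-none none xs

count-pos⇒∃ : (p : A → Bool) (xs : List A) → 0 < count p xs → ∃ λ x → p x ≡ true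
count-pos⇒∃ p (x ∷ xs) pos with p x in px
... | true  = x , px
... | false = count-pos⇒∃ p xs pos

∑ : (Fin q → ℕ) → ℕ
∑ f = sum (tabulate f)

term≤∑ : (f : Fin q → ℕ) (a : Fin q) → f a ≤ ∑ f
term≤∑ f Fin.zero    = m≤m+n _ _
term≤∑ f (Fin.suc a) = ≤-trans (term≤∑ (f ∘ Fin.suc) a) (m≤n+m _ _)

two-terms≤∑ : (f : Fin q → ℕ) {a b : Fin q} → a ≢ b → f a + f b ≤ ∑ f
two-terms≤∑ f {Fin.zero}  {Fin.zero}  a≢b = ⊥-elim (a≢b refl)
two-terms≤∑ f {Fin.zero}  {Fin.suc b} a≢b = +-monoʳ-≤ (f Fin.zero) (term≤∑ (f ∘ Fin.suc) b)
two-terms≤∑ f {Fin.suc a} {Fin.zero}  a≢b =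
  ≤-trans (≤-reflexive (+-comm (f (Fin.suc a)) _)) (two-terms≤∑ f {Fin.zero} (a≢b ∘ sym))
two-terms≤∑ f {Fin.suc a} {Fin.suc b} a≢b =
  ≤-trans (two-terms≤∑ (f ∘ Fin.suc) (a≢b ∘ cong Fin.suc)) (m≤n+m _ _)

∑-zero : (f : Fin q → ℕ) → (∀ a → f a ≡ 0) → ∑ f ≡ 0
∑-zero {zero}  f f≡0 = refl
∑-zero {suc q} f f≡0 rewrite f≡0 Fin.zero = ∑-zero (f ∘ Fin.suc) (f≡0 ∘ Fin.suc)

∑-single : (f : Fin q → ℕ) (c : Fin q) → (∀ a → a ≢ c → f a ≡ 0) → ∑ f ≡ f c
∑-single f Fin.zero off-c =
  trans (cong (f Fin.zero +_) (∑-zero (f ∘ Fin.suc) (λ a → off-c (Fin.suc a) λ ())))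
        (+-identityʳ _)
∑-single f (Fin.suc c) off-c rewrite off-c Fin.zero (λ ()) =
  ∑-single (f ∘ Fin.suc) c (λ a a≢c → off-c (Fin.suc a) (a≢c ∘ fsuc-injective))

slice : PointSet q (suc n) → Fin q → PointSet q n
slice S a x = S (a ∷ x)

card-slices : (S : PointSet q (suc n)) → card S ≡ ∑ (card ∘ slice S)
card-slices {q} {n} S = begin
  card S                                        ≡⟨ count-concatMap S prefixed (allFin q) ⟩
  sum (map (count S ∘ prefixed) (tabulate id))  ≡⟨ cong sum (map-tabulate id (count S ∘ prefixed)) ⟩
  ∑ (count S ∘ prefixed)                        ≡⟨ cong sum (tabulate-cong count-slice) ⟩
  ∑ (card ∘ slice S)                            ∎
  where
  open ≡-Reasoning
  prefixed : Fin q → List (Point q (suc n))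
  prefixed a = map (a ∷_) (allPoints q n)
  count-slice : ∀ a → count S (prefixed a) ≡ card (slice S a)
  count-slice a = count-map S (a ∷_) (allPoints q n)

card-cong : {S T : PointSet q n} → (∀ x → S x ≡ T x) → card S ≡ card T
card-cong {q} {n} S≗T = count-cong S≗T (allPoints q n)

card-mono : {S T : PointSet q n} → (∀ x → S x ≡ true → T x ≡ true) → card S ≤ card T
card-mono {q} {n} S⊆T = count-mono S⊆T (allPoints q n)

ConcentratedOn : PointSet q (suc n) → Fin q → Set
ConcentratedOn S c = ∀ a → a ≢ c → card (slice S a) ≡ 0

card-concentrated : (S : PointSet q (suc n)) (c : Fin q) → ConcentratedOn S c →
                    card S ≡ card (slice S c)
card-concentrated S c conc = trans (card-slices S) (∑-single (card ∘ slice S) c conc)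

cardInFace-fixed : (S : PointSet q (suc n)) (J : Subset n) (c : Fin q) (cs : Point q n) →
                   cardInFace S (true ∷ J) (c ∷ cs) ≡ cardInFace (slice S c) J cs
cardInFace-fixed {q} {n} S J c cs =
  trans (card-concentrated (λ x → S x ∧ inFace (true ∷ J) (c ∷ cs) x) c off-c) (card-cong on-c)
  where
  off-c : ∀ a → a ≢ c → count (λ x → S (a ∷ x) ∧ (⌊ c ≟F a ⌋ ∧ inFace J cs x)) (allPoints q n) ≡ 0
  off-c a a≢c with c ≟F a
  ... | yes c≡a = ⊥-elim (a≢c (sym c≡a))
  ... | no _    = count-none (λ x → ∧-zeroʳ (S (a ∷ x))) (allPoints q n)
  on-c : ∀ x → S (c ∷ x) ∧ (⌊ c ≟F c ⌋ ∧ inFace J cs x) ≡ S (c ∷ x) ∧ inFace J cs x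
  on-c x with c ≟F c
  ... | yes _  = refl
  ... | no c≢c = ⊥-elim (c≢c refl)

cardInFace-free : (S : PointSet q (suc n)) (J : Subset n) (c : Fin q) (cs : Point q n) →
                  ConcentratedOn S c →
                  cardInFace S (false ∷ J) (c ∷ cs) ≡ cardInFace (slice S c) J cs
cardInFace-free S J c cs conc =
  card-concentrated (λ x → S x ∧ inFace (false ∷ J) (c ∷ cs) x) c off-c
  where
  cardInFace≤card : ∀ a → cardInFace (slice S a) J cs ≤ card (slice S a)
  cardInFace≤card a = card-mono (λ x → ∧-conicalˡ (S (a ∷ x)) (inFace J cs x))
  off-c : ∀ a → a ≢ c → cardInFace (slice S a) J cs ≡ 0
  off-c a a≢c = n≤0⇒n≡0 (subst (cardInFace (slice S a) J cs ≤_) (conc a a≢c) (cardInFace≤card a))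

slice-isBitrade : (S : PointSet q (suc n)) (c : Fin q) →
                  IsBitrade (suc m) S → IsBitrade m (slice S c)
slice-isBitrade S c B J ∣J∣≡m cs =
  subst Even (cardInFace-fixed S J c cs) (B (true ∷ J) (cong suc ∣J∣≡m) (c ∷ cs))

concentrated-isBitrade : (S : PointSet q (suc n)) (c : Fin q) → ConcentratedOn S c →
                         IsBitrade m S → IsBitrade m (slice S c)
concentrated-isBitrade S c conc B J ∣J∣≡m cs =
  subst Even (cardInFace-free S J c cs conc) (B (false ∷ J) ∣J∣≡m (c ∷ cs))

inFace-⊥ : (a x : Point q n) → inFace ⊥ a x ≡ true
inFace-⊥ []       []       = refl
inFace-⊥ (_ ∷ as) (_ ∷ xs) = inFace-⊥ as xs

cardInFace-⊥ : (S : PointSet q n) (a : Point q n) → cardInFace S ⊥ a ≡ card S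
cardInFace-⊥ S a = card-cong (λ x → trans (cong (S x ∧_) (inFace-⊥ a x)) (∧-identityʳ (S x)))

card-point : (S : PointSet q 0) → S [] ≡ true → card S ≡ 1
card-point S S[] rewrite S[] = refl

nonempty⇒card-pos : (S : PointSet q n) → Nonempty S → 0 < card S
nonempty⇒card-pos {n = zero}  S ([] , S[]) = ≤-reflexive (sym (card-point S S[]))
nonempty⇒card-pos {n = suc n} S (c ∷ x , Scx) =
  ≤-trans (nonempty⇒card-pos (slice S c) (x , Scx))
          (≤-trans (term≤∑ (card ∘ slice S) c) (≤-reflexive (sym (card-slices S))))

card-pos⇒nonempty : (S : PointSet q n) → 0 < card S → Nonempty S
card-pos⇒nonempty {q} {n} S = count-pos⇒∃ S (allPoints q n)

¬Even-1 : ¬ Even 1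
¬Even-1 (zero  , ())
¬Even-1 (suc t , 1≡t+t) = m+1+n≢0 t (sym (suc-injective 1≡t+t))

Even∧pos⇒2≤ : {k : ℕ} → Even k → 0 < k → 2 ≤ k
Even∧pos⇒2≤ (zero  , refl) ()
Even∧pos⇒2≤ (suc t , refl) _ rewrite +-suc t t = s≤s (s≤s z≤n)

nonempty⇒¬isBitrade-full : (S : PointSet q n) → Nonempty S → ¬ IsBitrade n S
nonempty⇒¬isBitrade-full {n = zero}  S ([] , S[]) B =
  ¬Even-1 (subst Even (trans (cardInFace-⊥ S []) (card-point S S[])) (B [] refl []))
nonempty⇒¬isBitrade-full {n = suc n} S (c ∷ x , Scx) B =
  nonempty⇒¬isBitrade-full (slice S c) (x , Scx) (slice-isBitrade S c B)

bitrade-lower-bound : (S : PointSet q n) → m ≤ n → Nonempty S → IsBitrade m S →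
                      2 ^ suc m ≤ card S
bitrade-lower-bound {n = n} {m = zero} S _ ne@(x , _) B =
  Even∧pos⇒2≤ (subst Even (cardInFace-⊥ S x) (B ⊥ (∣⊥∣≡0 n) x)) (nonempty⇒card-pos S ne)
bitrade-lower-bound {n = suc n} {m = suc m} S (s≤s m≤n) ne@(c ∷ x , Scx) B
  with m≤n⇒m<n∨m≡n m≤n
... | inj₂ refl = ⊥-elim (nonempty⇒¬isBitrade-full S ne B)
... | inj₁ m<n with any? (λ b → ¬? (b ≟F c) ×-dec (0 <? card (slice S b)))
...   | yes (b , b≢c , pos) = begin
  2 ^ suc (suc m)                       ≡⟨ cong (2 ^ suc m +_) (+-identityʳ (2 ^ suc m)) ⟩
  2 ^ suc m + 2 ^ suc m                 ≤⟨ +-mono-≤ (slice-bound c (x , Scx)) (slice-bound b ne-b) ⟩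
  card (slice S c) + card (slice S b)   ≤⟨ two-terms≤∑ (card ∘ slice S) (b≢c ∘ sym) ⟩
  ∑ (card ∘ slice S)                    ≡⟨ card-slices S ⟨
  card S                                ∎
  where
  open ≤-Reasoning
  slice-bound : ∀ a → Nonempty (slice S a) → 2 ^ suc m ≤ card (slice S a)
  slice-bound a ne-a = bitrade-lower-bound (slice S a) m≤n ne-a (slice-isBitrade S a B)
  ne-b : Nonempty (slice S b)
  ne-b = card-pos⇒nonempty (slice S b) pos
...   | no ¬two-slices = begin
  2 ^ suc (suc m)   ≤⟨ bitrade-lower-bound (slice S c) m<n (x , Scx) B-c ⟩
  card (slice S c)  ≡⟨ card-concentrated S c conc ⟨
  card S            ∎
  where
  open ≤-Reasoning
  conc : ConcentratedOn S c
  conc a a≢c = n≤0⇒n≡0 (≮⇒≥ (λ pos → ¬two-slices (a , a≢c , pos)))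
  B-c : IsBitrade (suc m) (slice S c)
  B-c = concentrated-isBitrade S c conc B

proposition4 : (q n m : ℕ) → 2 < q → 1 ≤ n → m ≤ n →
    (S : PointSet q n) → Nonempty S → IsBitrade m S →
    2 ^ suc m ≤ card S
proposition4 q n m _ _ m≤n S ne B = bitrade-lower-bound S m≤n ne B
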